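{- If $L$ and $L'$ are finite semidistrim lattices, then the product lattice $L\times L'$ (ordered componentwise) is semidistrim.
   Context: All lattices are finite. For a lattice $L$, $\mathcal{J}_L$ (resp. $\mathcal{M}_L$) is the set of join-irreducible (resp. meet-irreducible) elements; for $j\in\mathcal{J}_L$, $j_*$ is the unique element covered by $j$, and for $m\in\mathcal{M}_L$, $m^*$ is the unique element covering $m$. Let $\mathcal{M}_L(j)=\max\{z\in L: j_*=j\wedge z\}$ and $\mathcal{J}_L(m)=\min\{z\in L: m^*=m\vee z\}$. A pairing on $L$ is a bijection $\kappa:\mathcal{J}_L\to\mathcal{M}_L$ with $\kappa(j)\in\mathcal{M}_L(j)$ for all $j$ and $\kappa^{ -1}(m)\in\mathcal{J}_L(m)$ for all $m$; $L$ is uniquely paired if it has exactly one pairing, denoted $\kappa_L$. A prime pair is a pair $(j_0,m_0)$ with $L=[\hat0,m_0]\sqcup[j_0,\hat1]$. A uniquely paired lattice $L$ is compatibly dismantlable if $|L|=1$ or there is a prime pair $(j_0,m_0)$ such that: (i) $[j_0,\hat1]$ is compatibly dismantlable and $\alpha(j)=j_0\vee j$ defines a bijection $\{j\in\mathcal{J}_L: j_0\le\kappa_L(j)\}\to\mathcal{J}_{[j_0,\hat1]}$ with $\kappa_{[j_0,\hat1]}(\alpha(j))=\kappa_L(j)$; (ii) $[\hat0,m_0]$ is compatibly dismantlable and $\beta(m)=m_0\wedge m$ defines a bijection $\{m\in\mathcal{M}_L:\kappa_L^{ -1}(m)\le m_0\}\to\mathcal{M}_{[\hat0,m_0]}$ with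 $\kappa_{[\hat0,m_0]}^{ -1}(\beta(m))=\kappa_L^{ -1}(m)$. The Galois graph $G_L$ is the directed graph on $\mathcal{J}_L$ with an edge $j\to j'$ iff $j\ne j'$ and $j\not\le\kappa_L(j')$. For $x\in L$ let $J_L(x)=\{j\in\mathcal{J}_L:j\le x\}$ and $M_L(x)=\{j\in\mathcal{J}_L:\kappa_L(j)\ge x\}$. For a compatibly dismantlable $L$, for every cover $x\lessdot y$ the set $M_L(x)\cap J_L(y)$ has exactly one element $j_{xy}$; set $\mathcal{D}_L(x)=\{j_{yx}:y\lessdot x\}$ and $\mathcal{U}_L(x)=\{j_{xy}:x\lessdot y\}$. $L$ is semidistrim if it is compatibly dismantlable and $\mathcal{D}_L(x)$, $\mathcal{U}_L(x)$ are independent sets (no two elements adjacent) of $G_L$ for all $x\in L$. -}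

module Defs where

open import Level using (0ℓ)
open import Data.Product using (Σ; ∃; ∃-syntax; _×_; _,_; proj₁; proj₂)
open import Data.Sum using (_⊎_; inj₁; inj₂)
open import Data.Empty using (⊥)
open import Data.List using (List; cartesianProduct)
open import Data.List.Membership.Propositional using (_∈_)
open import Data.List.Membership.Propositional.Properties using (∈-cartesianProduct⁺)
open import Relation.Nullary using (¬_)
open import Relation.Binary.PropositionalEquality using (_≡_; _≢_; refl; cong₂)

record FinLattice : Set₁ where
  infix 4 _≤_
  infixr 6 _∨_
  infixr 7 _∧_
  field
    Carrier : Set
    _≤_     : Carrier → Carrier → Set
    ≤-refl    : ∀ {x} → x ≤ x
    ≤-trans   : ∀ {x y z} → x ≤ y → y ≤ z → x ≤ z
    ≤-antisym : ∀ {x y} → x ≤ y → y ≤ x → x ≡ y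
    _∨_ : Carrier → Carrier → Carrier
    _∧_ : Carrier → Carrier → Carrier
    x≤x∨y : ∀ x y → x ≤ x ∨ y
    y≤x∨y : ∀ x y → y ≤ x ∨ y
    ∨-least : ∀ {x y z} → x ≤ z → y ≤ z → x ∨ y ≤ z
    x∧y≤x : ∀ x y → x ∧ y ≤ x
    x∧y≤y : ∀ x y → x ∧ y ≤ y
    ∧-greatest : ∀ {x y z} → z ≤ x → z ≤ y → z ≤ x ∧ y
    ⊤ ⊥L : Carrier
    ≤⊤ : ∀ x → x ≤ ⊤
    ⊥≤ : ∀ x → ⊥L ≤ x
    elements : List Carrier
    complete : ∀ x → x ∈ elements

_×L_ : FinLattice → FinLattice → FinLattice
L ×L L' = record
  { Carrier = L.Carrier × L'.Carrier
  ; _≤_ = λ p q → (proj₁ p L.≤ proj₁ q) × (proj₂ p L'.≤ proj₂ q)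
  ; ≤-refl = L.≤-refl , L'.≤-refl
  ; ≤-trans = λ (a , b) (c , d) → L.≤-trans a c , L'.≤-trans b d
  ; ≤-antisym = λ (a , b) (c , d) → cong₂ _,_ (L.≤-antisym a c) (L'.≤-antisym b d)
  ; _∨_ = λ p q → (proj₁ p L.∨ proj₁ q) , (proj₂ p L'.∨ proj₂ q)
  ; _∧_ = λ p q → (proj₁ p L.∧ proj₁ q) , (proj₂ p L'.∧ proj₂ q)
  ; x≤x∨y = λ p q → L.x≤x∨y _ _ , L'.x≤x∨y _ _
  ; y≤x∨y = λ p q → L.y≤x∨y _ _ , L'.y≤x∨y _ _
  ; ∨-least = λ (a , b) (c , d) → L.∨-least a c , L'.∨-least b d
  ; x∧y≤x = λ p q → L.x∧y≤x _ _ , L'.x∧y≤x _ _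
  ; x∧y≤y = λ p q → L.x∧y≤y _ _ , L'.x∧y≤y _ _
  ; ∧-greatest = λ (a , b) (c , d) → L.∧-greatest a c , L'.∧-greatest b d
  ; ⊤ = L.⊤ , L'.⊤
  ; ⊥L = L.⊥L , L'.⊥L
  ; ≤⊤ = λ p → L.≤⊤ _ , L'.≤⊤ _
  ; ⊥≤ = λ p → L.⊥≤ _ , L'.⊥≤ _
  ; elements = cartesianProduct L.elements L'.elements
  ; complete = λ p → ∈-cartesianProduct⁺ (L.complete (proj₁ p)) (L'.complete (proj₂ p))
  }
  where
    module L = FinLattice L
    module L' = FinLattice L'

-- All notions below are defined for the interval [a , b] of a finite
-- lattice L, regarded as a lattice in its own right (induced order,
-- joins, meets; bottom a, top b).  The lattice L itself is [⊥L , ⊤].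

module Notions (L : FinLattice) where
  open FinLattice L

  C = Carrier

  _<_ : C → C → Set
  x < y = x ≤ y × x ≢ y

  -- cover relation (for x, y in an interval, covering in the interval
  -- coincides with covering in L since intervals are convex)
  _⋖_ : C → C → Set
  x ⋖ y = x < y × (∀ z → x < z → z < y → ⊥)

  module Interval (a b : C) where

    In : C → Set
    In x = a ≤ x × x ≤ b

    JI : C → Set
    JI j = In j × j ≢ a × (∀ x y → In x → In y → j ≡ x ∨ y → j ≡ x ⊎ j ≡ y)

    MI : C → Set
    MI m = In m × m ≢ b × (∀ x y → In x → In y → m ≡ x ∧ y → m ≡ x ⊎ m ≡ y)

    -- z ∈ M(j) = max { z : j_* = j ∧ z }   (j_* the element covered by j)
    InMof : C → C → Set
    InMof j z = In z
      × (∀ c → In c → c ⋖ j → c ≡ j ∧ z)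
      × (∀ w → In w → (∀ c → In c → c ⋖ j → c ≡ j ∧ w) → z ≤ w → z ≡ w)

    -- z ∈ J(m) = min { z : m^* = m ∨ z }   (m^* the element covering m)
    InJof : C → C → Set
    InJof m z = In z
      × (∀ u → In u → m ⋖ u → u ≡ m ∨ z)
      × (∀ w → In w → (∀ u → In u → m ⋖ u → u ≡ m ∨ w) → w ≤ z → w ≡ z)

    IsPairing : (C → C) → Set
    IsPairing κ =
        (∀ j → JI j → MI (κ j))
      × (∀ j j' → JI j → JI j' → κ j ≡ κ j' → j ≡ j')
      × (∀ m → MI m → ∃[ j ] (JI j × κ j ≡ m))
      × (∀ j → JI j → InMof j (κ j))
      × (∀ j → JI j → InJof (κ j) j)

    -- exactly one pairing (pairings are functions on JI, so two pairings
    -- are identified when they agree on JI)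
    UniquelyPaired : Set
    UniquelyPaired = Σ (C → C) λ κ → IsPairing κ
      × (∀ κ' → IsPairing κ' → ∀ j → JI j → κ' j ≡ κ j)

    PrimePair : C → C → Set
    PrimePair j₀ m₀ = In j₀ × In m₀
      × (∀ x → In x → (x ≤ m₀ ⊎ j₀ ≤ x) × ¬ (x ≤ m₀ × j₀ ≤ x))

  open Interval

  -- compatibly dismantlable intervals (the unique pairing of an interval
  -- being given by the first component of a UniquelyPaired witness)
  data CompDism (a b : C) : Set where
    single : a ≡ b → CompDism a b
    step : (up : UniquelyPaired a b) (j₀ m₀ : C) → PrimePair a b j₀ m₀
      → (upT : UniquelyPaired j₀ b) → CompDism j₀ b
      → (let κ = proj₁ up ; κT = proj₁ upT
         in (∀ j → JI a b j → j₀ ≤ κ j → JI j₀ b (j₀ ∨ j) × κT (j₀ ∨ j) ≡ κ j)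
          × (∀ j j' → JI a b j → JI a b j' → j₀ ≤ κ j → j₀ ≤ κ j'
               → j₀ ∨ j ≡ j₀ ∨ j' → j ≡ j')
          × (∀ j' → JI j₀ b j' → ∃[ j ] (JI a b j × j₀ ≤ κ j × j₀ ∨ j ≡ j')))
      → (upB : UniquelyPaired a m₀) → CompDism a m₀
      → (let κ = proj₁ up ; κB = proj₁ upB
         in (∀ j → JI a b j → j ≤ m₀ → MI a m₀ (m₀ ∧ κ j) × JI a m₀ j × κB j ≡ m₀ ∧ κ j)
          × (∀ j j' → JI a b j → JI a b j' → j ≤ m₀ → j' ≤ m₀
               → m₀ ∧ κ j ≡ m₀ ∧ κ j' → κ j ≡ κ j')
          × (∀ m' → MI a m₀ m' → ∃[ j ] (JI a b j × j ≤ m₀ × m₀ ∧ κ j ≡ m')))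
      → CompDism a b

  JIL = JI ⊥L ⊤
  MIL = MI ⊥L ⊤

  module WithPairing (κ : C → C) where
    Edge : C → C → Set
    Edge j j' = j ≢ j' × ¬ (j ≤ κ j')

    Jset : C → C → Set
    Jset x j = JIL j × j ≤ x

    Mset : C → C → Set
    Mset x j = JIL j × x ≤ κ j

    InD : C → C → Set
    InD x j = ∃[ y ] (y ⋖ x × Mset y j × Jset x j)

    InU : C → C → Set
    InU x j = ∃[ y ] (x ⋖ y × Mset x j × Jset y j)

    Independent : (C → Set) → Set
    Independent S = ∀ j j' → S j → S j' → ¬ Edge j j'

  Semidistrim : Set
  Semidistrim = Σ (UniquelyPaired ⊥L ⊤) λ up → CompDism ⊥L ⊤
    × (∀ x → WithPairing.Independent (proj₁ up) (WithPairing.InD (proj₁ up) x)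
           × WithPairing.Independent (proj₁ up) (WithPairing.InU (proj₁ up) x))

Semidistrim : FinLattice → Set
Semidistrim L = Notions.Semidistrim L

module Submission where

-- In an interval [a , b] × [a' , b'] of L × L' the join-irreducibles are the pairs (j , a') and
-- (a , j') with j, j' join-irreducible in the factors, and dually for meet-irreducibles. The
-- pairing (j , a') ↦ (κ j , b'), (a , j') ↦ (b , κ' j') is the only one, because any pairing of
-- the product restricts to pairings of the factors. A prime pair (j₀ , m₀) of a factor gives the
-- prime pair ((j₀ , a') , (m₀ , b')) of the product, so compatible dismantlability follows by
-- induction on the dismantling of the first factor and then of the second; this recursion into
-- subintervals is why everything is stated for intervals. Finally, a cover in the product moves
-- exactly one coordinate, so 𝒟 and 𝒰 of (x , x') come from 𝒟 and 𝒰 of x and x', and irreducibles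
-- of the two kinds are never adjacent in the Galois graph.

open import Defs
open import Data.Product using (∃-syntax; _×_; _,_; proj₁; proj₂)
open import Data.Sum using (_⊎_; inj₁; inj₂; [_,_]) renaming (map to ⊎-map)
open import Data.Empty using (⊥; ⊥-elim)
open import Relation.Nullary using (¬_; Dec; yes; no)
open import Relation.Binary.Definitions using (DecidableEquality)
open import Relation.Binary.PropositionalEquality
  using (_≡_; _≢_; refl; sym; trans; cong; cong₂; subst; module ≡-Reasoning)

module LatticeProperties (L : FinLattice) where
  open FinLattice L
  open Notions L
  open Interval

  ≡⇒≤ : ∀ {x y} → x ≡ y → x ≤ y
  ≡⇒≤ refl = ≤-refl

  x≤y⇒x∨y≡y : ∀ {x y} → x ≤ y → x ∨ y ≡ y
  x≤y⇒x∨y≡y p = ≤-antisym (∨-least p ≤-refl) (y≤x∨y _ _)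

  y≤x⇒x∨y≡x : ∀ {x y} → y ≤ x → x ∨ y ≡ x
  y≤x⇒x∨y≡x p = ≤-antisym (∨-least ≤-refl p) (x≤x∨y _ _)

  x≤y⇒x∧y≡x : ∀ {x y} → x ≤ y → x ∧ y ≡ x
  x≤y⇒x∧y≡x p = ≤-antisym (x∧y≤x _ _) (∧-greatest ≤-refl p)

  y≤x⇒x∧y≡y : ∀ {x y} → y ≤ x → x ∧ y ≡ y
  y≤x⇒x∧y≡y p = ≤-antisym (x∧y≤y _ _) (∧-greatest p ≤-refl)

  ∨-idem : ∀ x → x ∨ x ≡ x
  ∨-idem x = x≤y⇒x∨y≡y ≤-refl

  ∧-idem : ∀ x → x ∧ x ≡ x
  ∧-idem x = x≤y⇒x∧y≡x ≤-refl

  In-singleton : ∀ {a b x} → a ≡ b → In a b x → x ≡ a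
  In-singleton e (ax , xb) = ≤-antisym (≤-trans xb (≡⇒≤ (sym e))) ax

  singleton-¬JI : ∀ {a b} → a ≡ b → ∀ j → ¬ JI a b j
  singleton-¬JI e j (ij , j≢a , _) = j≢a (In-singleton e ij)

  singleton-¬MI : ∀ {a b} → a ≡ b → ∀ m → ¬ MI a b m
  singleton-¬MI e m (im , m≢b , _) = m≢b (trans (In-singleton e im) e)

  module _ {a b : C} {κ : C → C} (p : IsPairing a b κ) where
    pairing-MI : ∀ j → JI a b j → MI a b (κ j)
    pairing-MI = proj₁ p

    pairing-injective : ∀ j j' → JI a b j → JI a b j' → κ j ≡ κ j' → j ≡ j'
    pairing-injective = proj₁ (proj₂ p)

    pairing-surjective : ∀ m → MI a b m → ∃[ j ] (JI a b j × κ j ≡ m)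
    pairing-surjective = proj₁ (proj₂ (proj₂ p))

    pairing-InMof : ∀ j → JI a b j → InMof a b j (κ j)
    pairing-InMof = proj₁ (proj₂ (proj₂ (proj₂ p)))

    pairing-InJof : ∀ j → JI a b j → InJof a b (κ j) j
    pairing-InJof = proj₂ (proj₂ (proj₂ (proj₂ p)))

  module _ {a b : C} (up : UniquelyPaired a b) where
    κ-of : C → C
    κ-of = proj₁ up

    κ-of-isPairing : IsPairing a b κ-of
    κ-of-isPairing = proj₁ (proj₂ up)

    κ-of-unique : ∀ κ' → IsPairing a b κ' → ∀ j → JI a b j → κ' j ≡ κ-of j
    κ-of-unique = proj₂ (proj₂ up)

  MeetIsLowerCover : C → C → C → C → Set
  MeetIsLowerCover a b j z = ∀ c → In a b c → c ⋖ j → c ≡ j ∧ z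

  JoinIsUpperCover : C → C → C → C → Set
  JoinIsUpperCover a b m z = ∀ u → In a b u → m ⋖ u → u ≡ m ∨ z

  UpperCompatible : C → C → C → (C → C) → (C → C) → Set
  UpperCompatible a b j₀ κ κT =
      (∀ j → JI a b j → j₀ ≤ κ j → JI j₀ b (j₀ ∨ j) × κT (j₀ ∨ j) ≡ κ j)
    × (∀ j j' → JI a b j → JI a b j' → j₀ ≤ κ j → j₀ ≤ κ j' → j₀ ∨ j ≡ j₀ ∨ j' → j ≡ j')
    × (∀ j' → JI j₀ b j' → ∃[ j ] (JI a b j × j₀ ≤ κ j × j₀ ∨ j ≡ j'))

  LowerCompatible : C → C → C → (C → C) → (C → C) → Set
  LowerCompatible a b m₀ κ κB =
      (∀ j → JI a b j → j ≤ m₀ → MI a m₀ (m₀ ∧ κ j) × JI a m₀ j × κB j ≡ m₀ ∧ κ j)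
    × (∀ j j' → JI a b j → JI a b j' → j ≤ m₀ → j' ≤ m₀ → m₀ ∧ κ j ≡ m₀ ∧ κ j' → κ j ≡ κ j')
    × (∀ m' → MI a m₀ m' → ∃[ j ] (JI a b j × j ≤ m₀ × m₀ ∧ κ j ≡ m'))

  JI⇒a∨j≢a∨a : ∀ {a b j} → JI a b j → a ∨ j ≢ a ∨ a
  JI⇒a∨j≢a∨a ((a≤j , _) , j≢a , _) e = j≢a (trans (sym (x≤y⇒x∨y≡y a≤j)) (trans e (∨-idem _)))

  module UpperCompatibleParts (a b j₀ : C) (κ κT : C → C) (c : UpperCompatible a b j₀ κ κT) where
    UpperCompatible-JI : ∀ j → JI a b j → j₀ ≤ κ j → JI j₀ b (j₀ ∨ j) × κT (j₀ ∨ j) ≡ κ j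
    UpperCompatible-JI = proj₁ c

    UpperCompatible-injective : ∀ j j' → JI a b j → JI a b j' → j₀ ≤ κ j → j₀ ≤ κ j'
      → j₀ ∨ j ≡ j₀ ∨ j' → j ≡ j'
    UpperCompatible-injective = proj₁ (proj₂ c)

    UpperCompatible-surjective : ∀ j' → JI j₀ b j' → ∃[ j ] (JI a b j × j₀ ≤ κ j × j₀ ∨ j ≡ j')
    UpperCompatible-surjective = proj₂ (proj₂ c)

  module LowerCompatibleParts (a b m₀ : C) (κ κB : C → C) (c : LowerCompatible a b m₀ κ κB) where
    LowerCompatible-MI : ∀ j → JI a b j → j ≤ m₀ → MI a m₀ (m₀ ∧ κ j) × JI a m₀ j × κB j ≡ m₀ ∧ κ j
    LowerCompatible-MI = proj₁ c

    LowerCompatible-injective : ∀ j j' → JI a b j → JI a b j' → j ≤ m₀ → j' ≤ m₀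
      → m₀ ∧ κ j ≡ m₀ ∧ κ j' → κ j ≡ κ j'
    LowerCompatible-injective = proj₁ (proj₂ c)

    LowerCompatible-surjective : ∀ m' → MI a m₀ m' → ∃[ j ] (JI a b j × j ≤ m₀ × m₀ ∧ κ j ≡ m')
    LowerCompatible-surjective = proj₂ (proj₂ c)

  CompDism⇒≤ : ∀ {a b} → CompDism a b → a ≤ b
  CompDism⇒≤ (single e) = ≡⇒≤ e
  CompDism⇒≤ (step _ _ _ ((aj₀ , j₀b) , _) _ _ _ _ _ _) = ≤-trans aj₀ j₀b

  CompDism⇒UniquelyPaired : ∀ {a b} → CompDism a b → UniquelyPaired a b
  CompDism⇒UniquelyPaired (single e) =
    (λ x → x) ,
    ((λ j jj → ⊥-elim (singleton-¬JI e j jj)) , (λ j _ jj _ _ → ⊥-elim (singleton-¬JI e j jj)) ,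
     (λ m mm → ⊥-elim (singleton-¬MI e m mm)) , (λ j jj → ⊥-elim (singleton-¬JI e j jj)) ,
     (λ j jj → ⊥-elim (singleton-¬JI e j jj))) ,
    λ _ _ j jj → ⊥-elim (singleton-¬JI e j jj)
  CompDism⇒UniquelyPaired (step up _ _ _ _ _ _ _ _ _) = up

  -- Recursion along the dismantling: a prime pair puts every element of the interval into
  -- exactly one of two smaller dismantlable intervals.

  CompDism-dec≡ : ∀ {a b} → CompDism a b → ∀ x y → In a b x → In a b y → Dec (x ≡ y)
  CompDism-dec≡ (single e) x y ix iy = yes (trans (In-singleton e ix) (sym (In-singleton e iy)))
  CompDism-dec≡ (step _ j₀ m₀ (_ , _ , split) _ cdT _ _ cdB _) x y ix iy
    with proj₁ (split x ix) | proj₁ (split y iy)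
  ... | inj₁ x≤m₀ | inj₁ y≤m₀ = CompDism-dec≡ cdB x y (proj₁ ix , x≤m₀) (proj₁ iy , y≤m₀)
  ... | inj₂ j₀≤x | inj₂ j₀≤y = CompDism-dec≡ cdT x y (j₀≤x , proj₂ ix) (j₀≤y , proj₂ iy)
  ... | inj₁ x≤m₀ | inj₂ j₀≤y = no λ e → proj₂ (split y iy) (subst (_≤ m₀) e x≤m₀ , j₀≤y)
  ... | inj₂ j₀≤x | inj₁ y≤m₀ = no λ e → proj₂ (split x ix) (subst (_≤ m₀) (sym e) y≤m₀ , j₀≤x)

  PrimePair-meet⋖j₀ : ∀ {a b j₀ m₀} → PrimePair a b j₀ m₀ → (j₀ ∧ m₀) ⋖ j₀
  PrimePair-meet⋖j₀ {j₀ = j₀} {m₀} (ij , im , split) =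
    (x∧y≤x _ _ , λ e → proj₂ (split j₀ ij) (subst (_≤ m₀) e (x∧y≤y _ _) , ≤-refl)) , gap
    where
    gap : ∀ z → (j₀ ∧ m₀) < z → z < j₀ → ⊥
    gap z (lz , nz) (zj , nzj)
      with proj₁ (split z (≤-trans (∧-greatest (proj₁ ij) (proj₁ im)) lz , ≤-trans zj (proj₂ ij)))
    ... | inj₁ z≤m₀ = nz (≤-antisym lz (∧-greatest zj z≤m₀))
    ... | inj₂ j₀≤z = nzj (≤-antisym zj j₀≤z)

  PrimePair-m₀⋖join : ∀ {a b j₀ m₀} → PrimePair a b j₀ m₀ → m₀ ⋖ (m₀ ∨ j₀)
  PrimePair-m₀⋖join {j₀ = j₀} {m₀} (ij , im , split) =
    (x≤x∨y _ _ , λ e → proj₂ (split j₀ ij) (subst (j₀ ≤_) (sym e) (y≤x∨y _ _) , ≤-refl)) , gap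
    where
    gap : ∀ z → m₀ < z → z < (m₀ ∨ j₀) → ⊥
    gap z (lz , nz) (zj , nzj)
      with proj₁ (split z (≤-trans (proj₁ im) lz , ≤-trans zj (∨-least (proj₂ im) (proj₂ ij))))
    ... | inj₁ z≤m₀ = nz (≤-antisym lz z≤m₀)
    ... | inj₂ j₀≤z = nzj (≤-antisym zj (∨-least lz j₀≤z))

  CompDism-lowerCover : ∀ {a b} → CompDism a b → ∀ x → In a b x → x ≢ a → ∃[ c ] (In a b c × c ⋖ x)
  CompDism-lowerCover (single e) x ix x≢a = ⊥-elim (x≢a (In-singleton e ix))
  CompDism-lowerCover (step _ j₀ m₀ pp@(ij , im , split) _ cdT _ _ cdB _) x ix x≢a
    with proj₁ (split x ix)
  ... | inj₁ x≤m₀ with CompDism-lowerCover cdB x (proj₁ ix , x≤m₀) x≢a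
  ...   | c , (ac , c≤m₀) , c⋖x = c , (ac , ≤-trans c≤m₀ (proj₂ im)) , c⋖x
  CompDism-lowerCover (step _ j₀ m₀ pp@(ij , im , split) _ cdT _ _ cdB _) x ix x≢a | inj₂ j₀≤x
    with CompDism-dec≡ cdT x j₀ (j₀≤x , proj₂ ix) (≤-refl , proj₂ ij)
  ... | yes refl = j₀ ∧ m₀ , (∧-greatest (proj₁ ij) (proj₁ im) , ≤-trans (x∧y≤x _ _) (proj₂ ij)) ,
                   PrimePair-meet⋖j₀ pp
  ... | no x≢j₀ with CompDism-lowerCover cdT x (j₀≤x , proj₂ ix) x≢j₀
  ...   | c , (j₀c , cb) , c⋖x = c , (≤-trans (proj₁ ij) j₀c , cb) , c⋖x

  CompDism-upperCover : ∀ {a b} → CompDism a b → ∀ x → In a b x → x ≢ b → ∃[ u ] (In a b u × x ⋖ u)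
  CompDism-upperCover (single e) x ix x≢b = ⊥-elim (x≢b (trans (In-singleton e ix) e))
  CompDism-upperCover (step _ j₀ m₀ pp@(ij , im , split) _ cdT _ _ cdB _) x ix x≢b
    with proj₁ (split x ix)
  ... | inj₂ j₀≤x with CompDism-upperCover cdT x (j₀≤x , proj₂ ix) x≢b
  ...   | u , (j₀u , ub) , x⋖u = u , (≤-trans (proj₁ ij) j₀u , ub) , x⋖u
  CompDism-upperCover (step _ j₀ m₀ pp@(ij , im , split) _ cdT _ _ cdB _) x ix x≢b | inj₁ x≤m₀
    with CompDism-dec≡ cdB x m₀ (proj₁ ix , x≤m₀) (proj₁ im , ≤-refl)
  ... | yes refl = m₀ ∨ j₀ , (≤-trans (proj₁ im) (x≤x∨y _ _) , ∨-least (proj₂ im) (proj₂ ij)) ,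
                   PrimePair-m₀⋖join pp
  ... | no x≢m₀ with CompDism-upperCover cdB x (proj₁ ix , x≤m₀) x≢m₀
  ...   | u , (au , u≤m₀) , x⋖u = u , (au , ≤-trans u≤m₀ (proj₂ im)) , x⋖u

  -- Some u covers κ j, and u = κ j ∨ j since j ∈ J(κ j); so j ≤ κ j would give u = κ j.
  pairing-j≰κj : ∀ {a b κ} → CompDism a b → IsPairing a b κ → ∀ j → JI a b j → ¬ (j ≤ κ j)
  pairing-j≰κj {κ = κ} cd p j jj j≤κj
    with CompDism-upperCover cd (κ j) (proj₁ (pairing-MI p j jj)) (proj₁ (proj₂ (pairing-MI p j jj)))
  ... | u , iu , κj⋖u =
    proj₂ (proj₁ κj⋖u)
      (sym (trans (proj₁ (proj₂ (pairing-InJof p j jj)) u iu κj⋖u) (y≤x⇒x∨y≡x j≤κj)))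

  CompDism⇒DecidableEquality : CompDism ⊥L ⊤ → DecidableEquality C
  CompDism⇒DecidableEquality cd x y = CompDism-dec≡ cd x y (⊥≤ x , ≤⊤ x) (⊥≤ y , ≤⊤ y)

module Product (L L' : FinLattice)
    (_≟₁_ : DecidableEquality (FinLattice.Carrier L)) (_≟₂_ : DecidableEquality (FinLattice.Carrier L')) where
  module A = FinLattice L
  module B = FinLattice L'
  module P = FinLattice (L ×L L')
  module NA = Notions L
  module NB = Notions L'
  module NP = Notions (L ×L L')
  module GA = LatticeProperties L
  module GB = LatticeProperties L'
  module GP = LatticeProperties (L ×L L')

  ⋖-fst : ∀ {Y X : P.Carrier} → Y NP.⋖ X → proj₂ Y ≡ proj₂ X → proj₁ Y NA.⋖ proj₁ X
  ⋖-fst {Y} {X} ((Y≤X , Y≢X) , gap) e₂ =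
    (proj₁ Y≤X , λ e₁ → Y≢X (cong₂ _,_ e₁ e₂)) ,
    λ z lz zx → gap (z , proj₂ X) ((proj₁ lz , GB.≡⇒≤ e₂) , λ e → proj₂ lz (cong proj₁ e))
                                  ((proj₁ zx , B.≤-refl) , λ e → proj₂ zx (cong proj₁ e))

  ⋖-snd : ∀ {Y X : P.Carrier} → Y NP.⋖ X → proj₁ Y ≡ proj₁ X → proj₂ Y NB.⋖ proj₂ X
  ⋖-snd {Y} {X} ((Y≤X , Y≢X) , gap) e₁ =
    (proj₂ Y≤X , λ e₂ → Y≢X (cong₂ _,_ e₁ e₂)) ,
    λ z lz zx → gap (proj₁ X , z) ((GA.≡⇒≤ e₁ , proj₁ lz) , λ e → proj₂ lz (cong proj₂ e))
                                  ((A.≤-refl , proj₁ zx) , λ e → proj₂ zx (cong proj₂ e))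

  ⋖-×ˡ : ∀ {c x} z' → c NA.⋖ x → (c , z') NP.⋖ (x , z')
  ⋖-×ˡ z' ((c≤x , c≢x) , gap) =
    ((c≤x , B.≤-refl) , λ e → c≢x (cong proj₁ e)) ,
    λ Z lz zx →
      let z₂≡z' = B.≤-antisym (proj₂ (proj₁ zx)) (proj₂ (proj₁ lz)) in
      gap (proj₁ Z) (proj₁ (proj₁ lz) , λ e → proj₂ lz (cong₂ _,_ e (sym z₂≡z')))
                    (proj₁ (proj₁ zx) , λ e → proj₂ zx (cong₂ _,_ e z₂≡z'))

  ⋖-×ʳ : ∀ {c x} z → c NB.⋖ x → (z , c) NP.⋖ (z , x)
  ⋖-×ʳ z ((c≤x , c≢x) , gap) =
    ((A.≤-refl , c≤x) , λ e → c≢x (cong proj₂ e)) ,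
    λ Z lz zx →
      let z₁≡z = A.≤-antisym (proj₁ (proj₁ zx)) (proj₁ (proj₁ lz)) in
      gap (proj₂ Z) (proj₂ (proj₁ lz) , λ e → proj₂ lz (cong₂ _,_ (sym z₁≡z) e))
                    (proj₂ (proj₁ zx) , λ e → proj₂ zx (cong₂ _,_ z₁≡z e))

  -- If both coordinates moved, (proj₁ X , proj₂ Y) would lie strictly between Y and X.
  ⋖-cases : ∀ {Y X : P.Carrier} → Y NP.⋖ X
    → (proj₁ Y NA.⋖ proj₁ X × proj₂ Y ≡ proj₂ X) ⊎ (proj₁ Y ≡ proj₁ X × proj₂ Y NB.⋖ proj₂ X)
  ⋖-cases {Y} {X} Y⋖X@((Y≤X , _) , gap) with proj₁ Y ≟₁ proj₁ X | proj₂ Y ≟₂ proj₂ X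
  ... | yes e₁ | _ = inj₂ (e₁ , ⋖-snd Y⋖X e₁)
  ... | no _ | yes e₂ = inj₁ (⋖-fst Y⋖X e₂ , e₂)
  ... | no n₁ | no n₂ = ⊥-elim
    (gap (proj₁ X , proj₂ Y) ((proj₁ Y≤X , B.≤-refl) , λ e → n₁ (cong proj₁ e))
                             ((A.≤-refl , proj₂ Y≤X) , λ e → n₂ (cong proj₂ e)))

  module ProductInterval (a b : A.Carrier) (a' b' : B.Carrier) (a≤b : a A.≤ b) (a'≤b' : a' B.≤ b') where
    open NA.Interval a b public using ()
      renaming (In to InA; JI to JIA; MI to MIA; InMof to InMofA; InJof to InJofA)
    open NB.Interval a' b' public using ()
      renaming (In to InB; JI to JIB; MI to MIB; InMof to InMofB; InJof to InJofB)
    open NP.Interval (a , a') (b , b') public using ()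
      renaming (In to InP; JI to JIP; MI to MIP; InMof to InMofP; InJof to InJofP; IsPairing to IsPairingP)

    MeetIsLowerCoverA JoinIsUpperCoverA : A.Carrier → A.Carrier → Set
    MeetIsLowerCoverA = GA.MeetIsLowerCover a b
    JoinIsUpperCoverA = GA.JoinIsUpperCover a b

    MeetIsLowerCoverB JoinIsUpperCoverB : B.Carrier → B.Carrier → Set
    MeetIsLowerCoverB = GB.MeetIsLowerCover a' b'
    JoinIsUpperCoverB = GB.JoinIsUpperCover a' b'

    MeetIsLowerCoverP JoinIsUpperCoverP : P.Carrier → P.Carrier → Set
    MeetIsLowerCoverP = GP.MeetIsLowerCover (a , a') (b , b')
    JoinIsUpperCoverP = GP.JoinIsUpperCover (a , a') (b , b')

    In-fst : ∀ {X} → InP X → InA (proj₁ X)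
    In-fst ((ax , _) , (xb , _)) = ax , xb

    In-snd : ∀ {X} → InP X → InB (proj₂ X)
    In-snd ((_ , ax') , (_ , xb')) = ax' , xb'

    In-× : ∀ {x x'} → InA x → InB x' → InP (x , x')
    In-× (ax , xb) (ax' , xb') = (ax , ax') , (xb , xb')

    In-bot₁ : ∀ {x'} → InB x' → InP (a , x')
    In-bot₁ = In-× (A.≤-refl , a≤b)

    In-top₁ : ∀ {x'} → InB x' → InP (b , x')
    In-top₁ = In-× (a≤b , A.≤-refl)

    In-bot₂ : ∀ {x} → InA x → InP (x , a')
    In-bot₂ ix = In-× ix (B.≤-refl , a'≤b')

    In-top₂ : ∀ {x} → InA x → InP (x , b')
    In-top₂ ix = In-× ix (a'≤b' , B.≤-refl)

    JI-×ˡ : ∀ x → JIA x → JIP (x , a')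
    JI-×ˡ x (ix , x≢a , irr) =
      In-bot₂ ix , (λ e → x≢a (cong proj₁ e)) ,
      λ Y Z iY iZ e →
        let y' = B.≤-antisym (B.≤-trans (B.x≤x∨y _ _) (GB.≡⇒≤ (sym (cong proj₂ e)))) (proj₁ (In-snd iY))
            z' = B.≤-antisym (B.≤-trans (B.y≤x∨y _ _) (GB.≡⇒≤ (sym (cong proj₂ e)))) (proj₁ (In-snd iZ))
        in ⊎-map (λ q → cong₂ _,_ q (sym y')) (λ q → cong₂ _,_ q (sym z'))
             (irr (proj₁ Y) (proj₁ Z) (In-fst iY) (In-fst iZ) (cong proj₁ e))

    JI-×ʳ : ∀ x' → JIB x' → JIP (a , x')
    JI-×ʳ x' (ix , x≢a' , irr) =
      In-bot₁ ix , (λ e → x≢a' (cong proj₂ e)) ,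
      λ Y Z iY iZ e →
        let y = A.≤-antisym (A.≤-trans (A.x≤x∨y _ _) (GA.≡⇒≤ (sym (cong proj₁ e)))) (proj₁ (In-fst iY))
            z = A.≤-antisym (A.≤-trans (A.y≤x∨y _ _) (GA.≡⇒≤ (sym (cong proj₁ e)))) (proj₁ (In-fst iZ))
        in ⊎-map (λ q → cong₂ _,_ (sym y) q) (λ q → cong₂ _,_ (sym z) q)
             (irr (proj₂ Y) (proj₂ Z) (In-snd iY) (In-snd iZ) (cong proj₂ e))

    MI-×ˡ : ∀ x → MIA x → MIP (x , b')
    MI-×ˡ x (ix , x≢b , irr) =
      In-top₂ ix , (λ e → x≢b (cong proj₁ e)) ,
      λ Y Z iY iZ e →
        let y' = B.≤-antisym (proj₂ (In-snd iY)) (B.≤-trans (GB.≡⇒≤ (cong proj₂ e)) (B.x∧y≤x _ _))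
            z' = B.≤-antisym (proj₂ (In-snd iZ)) (B.≤-trans (GB.≡⇒≤ (cong proj₂ e)) (B.x∧y≤y _ _))
        in ⊎-map (λ q → cong₂ _,_ q (sym y')) (λ q → cong₂ _,_ q (sym z'))
             (irr (proj₁ Y) (proj₁ Z) (In-fst iY) (In-fst iZ) (cong proj₁ e))

    MI-×ʳ : ∀ x' → MIB x' → MIP (b , x')
    MI-×ʳ x' (ix , x≢b' , irr) =
      In-top₁ ix , (λ e → x≢b' (cong proj₂ e)) ,
      λ Y Z iY iZ e →
        let y = A.≤-antisym (proj₂ (In-fst iY)) (A.≤-trans (GA.≡⇒≤ (cong proj₁ e)) (A.x∧y≤x _ _))
            z = A.≤-antisym (proj₂ (In-fst iZ)) (A.≤-trans (GA.≡⇒≤ (cong proj₁ e)) (A.x∧y≤y _ _))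
        in ⊎-map (λ q → cong₂ _,_ (sym y) q) (λ q → cong₂ _,_ (sym z) q)
             (irr (proj₂ Y) (proj₂ Z) (In-snd iY) (In-snd iZ) (cong proj₂ e))

    -- (x , x') = (x , a') ∨ (a , x'), so irreducibility forces one of the two.
    JI-cases : ∀ X → JIP X → (JIA (proj₁ X) × proj₂ X ≡ a') ⊎ (proj₁ X ≡ a × JIB (proj₂ X))
    JI-cases (x , x') (iX , X≢a , irr)
      with irr (x , a') (a , x') (In-bot₂ (In-fst iX)) (In-bot₁ (In-snd iX))
               (sym (cong₂ _,_ (GA.y≤x⇒x∨y≡x (proj₁ (In-fst iX))) (GB.x≤y⇒x∨y≡y (proj₁ (In-snd iX)))))
    ... | inj₁ e =
      inj₁ ((In-fst iX , (λ q → X≢a (cong₂ _,_ q (cong proj₂ e))) ,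
             λ y z iy iz y∨z → ⊎-map (cong proj₁) (cong proj₁)
               (irr (y , a') (z , a') (In-bot₂ iy) (In-bot₂ iz) (trans e (cong₂ _,_ y∨z (sym (GB.∨-idem a')))))) ,
            cong proj₂ e)
    ... | inj₂ e =
      inj₂ (cong proj₁ e ,
            (In-snd iX , (λ q → X≢a (cong₂ _,_ (cong proj₁ e) q)) ,
             λ y z iy iz y∨z → ⊎-map (cong proj₂) (cong proj₂)
               (irr (a , y) (a , z) (In-bot₁ iy) (In-bot₁ iz) (trans e (cong₂ _,_ (sym (GA.∨-idem a)) y∨z)))))

    JI-×ˡ⁻ : ∀ x → JIP (x , a') → JIA x
    JI-×ˡ⁻ x jX with JI-cases (x , a') jX
    ... | inj₁ (jx , _) = jx
    ... | inj₂ (_ , (_ , a'≢a' , _)) = ⊥-elim (a'≢a' refl)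

    JI-×ʳ⁻ : ∀ x' → JIP (a , x') → JIB x'
    JI-×ʳ⁻ x' jX with JI-cases (a , x') jX
    ... | inj₂ (_ , jx') = jx'
    ... | inj₁ ((_ , a≢a , _) , _) = ⊥-elim (a≢a refl)

    MI-cases : ∀ X → MIP X → (MIA (proj₁ X) × proj₂ X ≡ b') ⊎ (proj₁ X ≡ b × MIB (proj₂ X))
    MI-cases (x , x') (iX , X≢b , irr)
      with irr (x , b') (b , x') (In-top₂ (In-fst iX)) (In-top₁ (In-snd iX))
               (sym (cong₂ _,_ (GA.x≤y⇒x∧y≡x (proj₂ (In-fst iX))) (GB.y≤x⇒x∧y≡y (proj₂ (In-snd iX)))))
    ... | inj₁ e =
      inj₁ ((In-fst iX , (λ q → X≢b (cong₂ _,_ q (cong proj₂ e))) ,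
             λ y z iy iz y∧z → ⊎-map (cong proj₁) (cong proj₁)
               (irr (y , b') (z , b') (In-top₂ iy) (In-top₂ iz) (trans e (cong₂ _,_ y∧z (sym (GB.∧-idem b')))))) ,
            cong proj₂ e)
    ... | inj₂ e =
      inj₂ (cong proj₁ e ,
            (In-snd iX , (λ q → X≢b (cong₂ _,_ (cong proj₁ e) q)) ,
             λ y z iy iz y∧z → ⊎-map (cong proj₂) (cong proj₂)
               (irr (b , y) (b , z) (In-top₁ iy) (In-top₁ iz) (trans e (cong₂ _,_ (sym (GA.∧-idem b)) y∧z)))))

    MeetIsLowerCover-×ˡ⁺ : ∀ {j z} → MeetIsLowerCoverA j z → MeetIsLowerCoverP (j , a') (z , b')
    MeetIsLowerCover-×ˡ⁺ h C iC C⋖ =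
      let C₂≡a' = B.≤-antisym (proj₂ (proj₁ (proj₁ C⋖))) (proj₁ (In-snd iC)) in
      cong₂ _,_ (h (proj₁ C) (In-fst iC) (⋖-fst C⋖ C₂≡a')) (trans C₂≡a' (sym (GB.x≤y⇒x∧y≡x a'≤b')))

    MeetIsLowerCover-×ʳ⁺ : ∀ {j z} → MeetIsLowerCoverB j z → MeetIsLowerCoverP (a , j) (b , z)
    MeetIsLowerCover-×ʳ⁺ h C iC C⋖ =
      let C₁≡a = A.≤-antisym (proj₁ (proj₁ (proj₁ C⋖))) (proj₁ (In-fst iC)) in
      cong₂ _,_ (trans C₁≡a (sym (GA.x≤y⇒x∧y≡x a≤b))) (h (proj₂ C) (In-snd iC) (⋖-snd C⋖ C₁≡a))

    MeetIsLowerCover-×ˡ⁻ : ∀ {j Z} → MeetIsLowerCoverP (j , a') Z → MeetIsLowerCoverA j (proj₁ Z)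
    MeetIsLowerCover-×ˡ⁻ h c ic c⋖ = cong proj₁ (h (c , a') (In-bot₂ ic) (⋖-×ˡ a' c⋖))

    MeetIsLowerCover-×ʳ⁻ : ∀ {j Z} → MeetIsLowerCoverP (a , j) Z → MeetIsLowerCoverB j (proj₂ Z)
    MeetIsLowerCover-×ʳ⁻ h c ic c⋖ = cong proj₂ (h (a , c) (In-bot₁ ic) (⋖-×ʳ a c⋖))

    JoinIsUpperCover-×ˡ⁺ : ∀ {m z} → JoinIsUpperCoverA m z → JoinIsUpperCoverP (m , b') (z , a')
    JoinIsUpperCover-×ˡ⁺ h U iU ⋖U =
      let U₂≡b' = B.≤-antisym (proj₂ (In-snd iU)) (proj₂ (proj₁ (proj₁ ⋖U))) in
      cong₂ _,_ (h (proj₁ U) (In-fst iU) (⋖-fst ⋖U (sym U₂≡b'))) (trans U₂≡b' (sym (GB.y≤x⇒x∨y≡x a'≤b')))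

    JoinIsUpperCover-×ʳ⁺ : ∀ {m z} → JoinIsUpperCoverB m z → JoinIsUpperCoverP (b , m) (a , z)
    JoinIsUpperCover-×ʳ⁺ h U iU ⋖U =
      let U₁≡b = A.≤-antisym (proj₂ (In-fst iU)) (proj₁ (proj₁ (proj₁ ⋖U))) in
      cong₂ _,_ (trans U₁≡b (sym (GA.y≤x⇒x∨y≡x a≤b))) (h (proj₂ U) (In-snd iU) (⋖-snd ⋖U (sym U₁≡b)))

    JoinIsUpperCover-×ˡ⁻ : ∀ {m Z} → JoinIsUpperCoverP (m , b') Z → JoinIsUpperCoverA m (proj₁ Z)
    JoinIsUpperCover-×ˡ⁻ h u iu ⋖u = cong proj₁ (h (u , b') (In-top₂ iu) (⋖-×ˡ b' ⋖u))

    JoinIsUpperCover-×ʳ⁻ : ∀ {m Z} → JoinIsUpperCoverP (b , m) Z → JoinIsUpperCoverB m (proj₂ Z)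
    JoinIsUpperCover-×ʳ⁻ h u iu ⋖u = cong proj₂ (h (b , u) (In-top₁ iu) (⋖-×ʳ b ⋖u))

    InMof-×ˡ⁺ : ∀ {j m} → InMofA j m → InMofP (j , a') (m , b')
    InMof-×ˡ⁺ (im , lower , maximal) =
      In-top₂ im , MeetIsLowerCover-×ˡ⁺ lower ,
      λ W iW hW le → cong₂ _,_ (maximal (proj₁ W) (In-fst iW) (MeetIsLowerCover-×ˡ⁻ hW) (proj₁ le))
                               (B.≤-antisym (proj₂ le) (proj₂ (In-snd iW)))

    InMof-×ʳ⁺ : ∀ {j m} → InMofB j m → InMofP (a , j) (b , m)
    InMof-×ʳ⁺ (im , lower , maximal) =
      In-top₁ im , MeetIsLowerCover-×ʳ⁺ lower ,
      λ W iW hW le → cong₂ _,_ (A.≤-antisym (proj₁ le) (proj₂ (In-fst iW)))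
                               (maximal (proj₂ W) (In-snd iW) (MeetIsLowerCover-×ʳ⁻ hW) (proj₂ le))

    InMof-×ˡ⁻ : ∀ {j M} → InMofP (j , a') M → InMofA j (proj₁ M)
    InMof-×ˡ⁻ (iM , lower , maximal) =
      In-fst iM , MeetIsLowerCover-×ˡ⁻ lower ,
      λ w iw hw le →
        cong proj₁ (maximal (w , b') (In-top₂ iw) (MeetIsLowerCover-×ˡ⁺ hw) (le , proj₂ (In-snd iM)))

    InMof-×ʳ⁻ : ∀ {j M} → InMofP (a , j) M → InMofB j (proj₂ M)
    InMof-×ʳ⁻ (iM , lower , maximal) =
      In-snd iM , MeetIsLowerCover-×ʳ⁻ lower ,
      λ w iw hw le →
        cong proj₂ (maximal (b , w) (In-top₁ iw) (MeetIsLowerCover-×ʳ⁺ hw) (proj₂ (In-fst iM) , le))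

    InJof-×ˡ⁺ : ∀ {m j} → InJofA m j → InJofP (m , b') (j , a')
    InJof-×ˡ⁺ (ij , upper , minimal) =
      In-bot₂ ij , JoinIsUpperCover-×ˡ⁺ upper ,
      λ W iW hW le → cong₂ _,_ (minimal (proj₁ W) (In-fst iW) (JoinIsUpperCover-×ˡ⁻ hW) (proj₁ le))
                               (B.≤-antisym (proj₂ le) (proj₁ (In-snd iW)))

    InJof-×ʳ⁺ : ∀ {m j} → InJofB m j → InJofP (b , m) (a , j)
    InJof-×ʳ⁺ (ij , upper , minimal) =
      In-bot₁ ij , JoinIsUpperCover-×ʳ⁺ upper ,
      λ W iW hW le → cong₂ _,_ (A.≤-antisym (proj₁ le) (proj₁ (In-fst iW)))
                               (minimal (proj₂ W) (In-snd iW) (JoinIsUpperCover-×ʳ⁻ hW) (proj₂ le))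

    InJof-×ˡ⁻ : ∀ {m j} → InJofP (m , b') (j , a') → InJofA m j
    InJof-×ˡ⁻ (ij , upper , minimal) =
      In-fst ij , JoinIsUpperCover-×ˡ⁻ upper ,
      λ w iw hw le → cong proj₁ (minimal (w , a') (In-bot₂ iw) (JoinIsUpperCover-×ˡ⁺ hw) (le , B.≤-refl))

    InJof-×ʳ⁻ : ∀ {m j} → InJofP (b , m) (a , j) → InJofB m j
    InJof-×ʳ⁻ (ij , upper , minimal) =
      In-snd ij , JoinIsUpperCover-×ʳ⁻ upper ,
      λ w iw hw le → cong proj₂ (minimal (a , w) (In-bot₁ iw) (JoinIsUpperCover-×ʳ⁺ hw) (A.≤-refl , le))

    module Pairing (up : NA.Interval.UniquelyPaired a b) (cd : NA.CompDism a b)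
                   (up' : NB.Interval.UniquelyPaired a' b') (cd' : NB.CompDism a' b') where
      κ : A.Carrier → A.Carrier
      κ = GA.κ-of up

      κ' : B.Carrier → B.Carrier
      κ' = GB.κ-of up'

      pA : NA.Interval.IsPairing a b κ
      pA = GA.κ-of-isPairing up

      pB : NB.Interval.IsPairing a' b' κ'
      pB = GB.κ-of-isPairing up'

      κP : P.Carrier → P.Carrier
      κP (x , x') with x' ≟₂ a'
      ... | yes _ = κ x , b'
      ... | no _ = b , κ' x'

      κP-fst : ∀ X → proj₂ X ≡ a' → κP X ≡ (κ (proj₁ X) , b')
      κP-fst (x , x') refl with a' ≟₂ a'
      ... | yes _ = refl
      ... | no a'≢a' = ⊥-elim (a'≢a' refl)

      κP-snd : ∀ X → JIB (proj₂ X) → κP X ≡ (b , κ' (proj₂ X))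
      κP-snd (x , x') (_ , x'≢a' , _) with x' ≟₂ a'
      ... | yes x'≡a' = ⊥-elim (x'≢a' x'≡a')
      ... | no _ = refl

      κP-MI : ∀ J → JIP J → MIP (κP J)
      κP-MI J jJ with JI-cases J jJ
      ... | inj₁ (jj , e) = subst MIP (sym (κP-fst J e)) (MI-×ˡ _ (GA.pairing-MI pA _ jj))
      ... | inj₂ (_ , jj) = subst MIP (sym (κP-snd J jj)) (MI-×ʳ _ (GB.pairing-MI pB _ jj))

      κP-injective : ∀ J K → JIP J → JIP K → κP J ≡ κP K → J ≡ K
      κP-injective J K jJ jK e with JI-cases J jJ | JI-cases K jK
      ... | inj₁ (jj , eJ) | inj₁ (kk , eK) =
        cong₂ _,_ (GA.pairing-injective pA _ _ jj kk (cong proj₁ κJ≡κK)) (trans eJ (sym eK))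
        where
        κJ≡κK : (κ (proj₁ J) , b') ≡ (κ (proj₁ K) , b')
        κJ≡κK = trans (sym (κP-fst J eJ)) (trans e (κP-fst K eK))
      ... | inj₁ (_ , eJ) | inj₂ (_ , kk) =
        ⊥-elim (proj₁ (proj₂ (GB.pairing-MI pB _ kk))
                 (sym (cong proj₂ (trans (sym (κP-fst J eJ)) (trans e (κP-snd K kk))))))
      ... | inj₂ (_ , jj) | inj₁ (_ , eK) =
        ⊥-elim (proj₁ (proj₂ (GB.pairing-MI pB _ jj))
                 (cong proj₂ (trans (sym (κP-snd J jj)) (trans e (κP-fst K eK)))))
      ... | inj₂ (eJ , jj) | inj₂ (eK , kk) =
        cong₂ _,_ (trans eJ (sym eK)) (GB.pairing-injective pB _ _ jj kk (cong proj₂ κ'J≡κ'K))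
        where
        κ'J≡κ'K : (b , κ' (proj₂ J)) ≡ (b , κ' (proj₂ K))
        κ'J≡κ'K = trans (sym (κP-snd J jj)) (trans e (κP-snd K kk))

      κP-surjective : ∀ M → MIP M → ∃[ J ] (JIP J × κP J ≡ M)
      κP-surjective M mM with MI-cases M mM
      ... | inj₁ (mm , e) with GA.pairing-surjective pA _ mm
      ...   | j , jj , κj≡ = (j , a') , JI-×ˡ j jj , trans (κP-fst (j , a') refl) (cong₂ _,_ κj≡ (sym e))
      κP-surjective M mM | inj₂ (e , mm) with GB.pairing-surjective pB _ mm
      ...   | j' , jj , κj≡ = (a , j') , JI-×ʳ j' jj , trans (κP-snd (a , j') jj) (cong₂ _,_ (sym e) κj≡)

      κP-InMof : ∀ J → JIP J → InMofP J (κP J)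
      κP-InMof (j , j') jJ with JI-cases (j , j') jJ
      ... | inj₁ (jj , refl) =
        subst (InMofP (j , a')) (sym (κP-fst (j , a') refl)) (InMof-×ˡ⁺ (GA.pairing-InMof pA j jj))
      ... | inj₂ (refl , jj) =
        subst (InMofP (a , j')) (sym (κP-snd (a , j') jj)) (InMof-×ʳ⁺ (GB.pairing-InMof pB j' jj))

      κP-InJof : ∀ J → JIP J → InJofP (κP J) J
      κP-InJof (j , j') jJ with JI-cases (j , j') jJ
      ... | inj₁ (jj , refl) =
        subst (λ M → InJofP M (j , a')) (sym (κP-fst (j , a') refl)) (InJof-×ˡ⁺ (GA.pairing-InJof pA j jj))
      ... | inj₂ (refl , jj) =
        subst (λ M → InJofP M (a , j')) (sym (κP-snd (a , j') jj)) (InJof-×ʳ⁺ (GB.pairing-InJof pB j' jj))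

      κP-isPairing : IsPairingP κP
      κP-isPairing = κP-MI , κP-injective , κP-surjective , κP-InMof , κP-InJof

      -- Any pairing ρ of the product restricts to pairings ρ₁, ρ₂ of the factors, which
      -- are κ and κ' by uniqueness there.
      module Uniqueness (ρ : P.Carrier → P.Carrier) (pρ : IsPairingP ρ) where
        open ≡-Reasoning

        -- If ρ (j , a') were (b , m'), a lower cover c of j would satisfy c = j ∧ b = j.
        ρ-fst-form : ∀ j → JIA j → MIA (proj₁ (ρ (j , a'))) × proj₂ (ρ (j , a')) ≡ b'
        ρ-fst-form j jj with MI-cases (ρ (j , a')) (GP.pairing-MI pρ (j , a') (JI-×ˡ j jj))
        ... | inj₁ r = r
        ... | inj₂ (e , _) with GA.CompDism-lowerCover cd j (proj₁ jj) (proj₁ (proj₂ jj))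
        ...   | c , ic , c⋖j =
          let (_ , lower , _) = InMof-×ˡ⁻ (GP.pairing-InMof pρ (j , a') (JI-×ˡ j jj)) in
          ⊥-elim (proj₂ (proj₁ c⋖j)
                   (trans (lower c ic c⋖j) (trans (cong (j A.∧_) e) (GA.x≤y⇒x∧y≡x (proj₂ (proj₁ jj))))))

        ρ-snd-form : ∀ j' → JIB j' → MIB (proj₂ (ρ (a , j'))) × proj₁ (ρ (a , j')) ≡ b
        ρ-snd-form j' jj with MI-cases (ρ (a , j')) (GP.pairing-MI pρ (a , j') (JI-×ʳ j' jj))
        ... | inj₂ (e , m) = m , e
        ... | inj₁ (_ , e) with GB.CompDism-lowerCover cd' j' (proj₁ jj) (proj₁ (proj₂ jj))
        ...   | c , ic , c⋖j' =
          let (_ , lower , _) = InMof-×ʳ⁻ (GP.pairing-InMof pρ (a , j') (JI-×ʳ j' jj)) in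
          ⊥-elim (proj₂ (proj₁ c⋖j')
                   (trans (lower c ic c⋖j') (trans (cong (j' B.∧_) e) (GB.x≤y⇒x∧y≡x (proj₂ (proj₁ jj))))))

        ρ₁ : A.Carrier → A.Carrier
        ρ₁ x = proj₁ (ρ (x , a'))

        ρ₂ : B.Carrier → B.Carrier
        ρ₂ x' = proj₂ (ρ (a , x'))

        ρ-fst : ∀ j → JIA j → ρ (j , a') ≡ (ρ₁ j , b')
        ρ-fst j jj = cong₂ _,_ refl (proj₂ (ρ-fst-form j jj))

        ρ-snd : ∀ j' → JIB j' → ρ (a , j') ≡ (b , ρ₂ j')
        ρ-snd j' jj = cong₂ _,_ (proj₂ (ρ-snd-form j' jj)) refl

        ρ₁-surjective : ∀ m → MIA m → ∃[ j ] (JIA j × ρ₁ j ≡ m)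
        ρ₁-surjective m mm with GP.pairing-surjective pρ (m , b') (MI-×ˡ m mm)
        ... | J , jJ , ρJ≡ with JI-cases J jJ
        ...   | inj₁ (jj , refl) = proj₁ J , jj , cong proj₁ ρJ≡
        ...   | inj₂ (refl , jj) =
          ⊥-elim (proj₁ (proj₂ mm) (trans (sym (cong proj₁ ρJ≡)) (proj₂ (ρ-snd-form _ jj))))

        ρ₂-surjective : ∀ m' → MIB m' → ∃[ j' ] (JIB j' × ρ₂ j' ≡ m')
        ρ₂-surjective m' mm with GP.pairing-surjective pρ (b , m') (MI-×ʳ m' mm)
        ... | J , jJ , ρJ≡ with JI-cases J jJ
        ...   | inj₂ (refl , jj) = proj₂ J , jj , cong proj₂ ρJ≡
        ...   | inj₁ (jj , refl) =
          ⊥-elim (proj₁ (proj₂ mm) (trans (sym (cong proj₂ ρJ≡)) (proj₂ (ρ-fst-form _ jj))))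

        ρ₁-isPairing : NA.Interval.IsPairing a b ρ₁
        ρ₁-isPairing =
          (λ j jj → proj₁ (ρ-fst-form j jj)) ,
          (λ j k jj kk e → cong proj₁ (GP.pairing-injective pρ (j , a') (k , a') (JI-×ˡ j jj) (JI-×ˡ k kk)
              (trans (ρ-fst j jj) (trans (cong₂ _,_ e refl) (sym (ρ-fst k kk)))))) ,
          ρ₁-surjective ,
          (λ j jj → InMof-×ˡ⁻ (GP.pairing-InMof pρ (j , a') (JI-×ˡ j jj))) ,
          (λ j jj → InJof-×ˡ⁻ (subst (λ M → InJofP M (j , a')) (ρ-fst j jj)
                                     (GP.pairing-InJof pρ (j , a') (JI-×ˡ j jj))))

        ρ₂-isPairing : NB.Interval.IsPairing a' b' ρ₂
        ρ₂-isPairing =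
          (λ j jj → proj₁ (ρ-snd-form j jj)) ,
          (λ j k jj kk e → cong proj₂ (GP.pairing-injective pρ (a , j) (a , k) (JI-×ʳ j jj) (JI-×ʳ k kk)
              (trans (ρ-snd j jj) (trans (cong₂ _,_ refl e) (sym (ρ-snd k kk)))))) ,
          ρ₂-surjective ,
          (λ j jj → InMof-×ʳ⁻ (GP.pairing-InMof pρ (a , j) (JI-×ʳ j jj))) ,
          (λ j jj → InJof-×ʳ⁻ (subst (λ M → InJofP M (a , j)) (ρ-snd j jj)
                                     (GP.pairing-InJof pρ (a , j) (JI-×ʳ j jj))))

        ρ≡κP : ∀ J → JIP J → ρ J ≡ κP J
        ρ≡κP (j , j') jJ with JI-cases (j , j') jJ
        ... | inj₁ (jj , refl) = begin
          ρ (j , a')    ≡⟨ ρ-fst j jj ⟩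
          (ρ₁ j , b')   ≡⟨ cong (_, b') (GA.κ-of-unique up ρ₁ ρ₁-isPairing j jj) ⟩
          (κ j , b')    ≡⟨ sym (κP-fst (j , a') refl) ⟩
          κP (j , a')   ∎
        ... | inj₂ (refl , jj) = begin
          ρ (a , j')    ≡⟨ ρ-snd j' jj ⟩
          (b , ρ₂ j')   ≡⟨ cong (b ,_) (GB.κ-of-unique up' ρ₂ ρ₂-isPairing j' jj) ⟩
          (b , κ' j')   ≡⟨ sym (κP-snd (a , j') jj) ⟩
          κP (a , j')   ∎

      ×-uniquelyPaired : NP.Interval.UniquelyPaired (a , a') (b , b')
      ×-uniquelyPaired = κP , κP-isPairing , Uniqueness.ρ≡κP

  module DismantlingStepˡ {a b : A.Carrier} {a' b' : B.Carrier}
     (up : NA.Interval.UniquelyPaired a b) (j₀ m₀ : A.Carrier) (pp : NA.Interval.PrimePair a b j₀ m₀)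
     (upT : NA.Interval.UniquelyPaired j₀ b) (cdT : NA.CompDism j₀ b)
     (cT : GA.UpperCompatible a b j₀ (GA.κ-of up) (GA.κ-of upT))
     (upB : NA.Interval.UniquelyPaired a m₀) (cdB : NA.CompDism a m₀)
     (cB : GA.LowerCompatible a b m₀ (GA.κ-of up) (GA.κ-of upB))
     (cd' : NB.CompDism a' b') where
    cd : NA.CompDism a b
    cd = NA.step up j₀ m₀ pp upT cdT cT upB cdB cB

    up' : NB.Interval.UniquelyPaired a' b'
    up' = GB.CompDism⇒UniquelyPaired cd'

    a≤j₀ : a A.≤ j₀
    a≤j₀ = proj₁ (proj₁ pp)

    j₀≤b : j₀ A.≤ b
    j₀≤b = proj₂ (proj₁ pp)

    a≤m₀ : a A.≤ m₀
    a≤m₀ = proj₁ (proj₁ (proj₂ pp))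

    m₀≤b : m₀ A.≤ b
    m₀≤b = proj₂ (proj₁ (proj₂ pp))

    a'≤b' : a' B.≤ b'
    a'≤b' = GB.CompDism⇒≤ cd'

    module I = ProductInterval a b a' b' (A.≤-trans a≤j₀ j₀≤b) a'≤b'
    module IT = ProductInterval j₀ b a' b' j₀≤b a'≤b'
    module IB = ProductInterval a m₀ a' b' a≤m₀ a'≤b'
    module U = I.Pairing up cd up' cd'
    module UT = IT.Pairing upT cdT up' cd'
    module UB = IB.Pairing upB cdB up' cd'
    open GA.UpperCompatibleParts a b j₀ (GA.κ-of up) (GA.κ-of upT) cT
    open GA.LowerCompatibleParts a b m₀ (GA.κ-of up) (GA.κ-of upB) cB

    ×-primePair : NP.Interval.PrimePair (a , a') (b , b') (j₀ , a') (m₀ , b')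
    ×-primePair =
      let (_ , _ , split) = pp in
      I.In-bot₂ (a≤j₀ , j₀≤b) , I.In-top₂ (a≤m₀ , m₀≤b) ,
      λ X iX → ⊎-map (_, proj₂ (I.In-snd iX)) (_, proj₁ (I.In-snd iX)) (proj₁ (split (proj₁ X) (I.In-fst iX))) ,
               λ (X≤M , J≤X) → proj₂ (split (proj₁ X) (I.In-fst iX)) (proj₁ X≤M , proj₁ J≤X)

    upper-JI : ∀ J → I.JIP J → (j₀ , a') P.≤ U.κP J
      → IT.JIP ((j₀ , a') P.∨ J) × UT.κP ((j₀ , a') P.∨ J) ≡ U.κP J
    upper-JI (j , j') jJ j₀≤κJ with I.JI-cases (j , j') jJ
    ... | inj₁ (jj , refl) =
      let j₀≤κj = proj₁ (subst ((j₀ , a') P.≤_) (U.κP-fst (j , a') refl) j₀≤κJ)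
          (jj∨ , κT≡κ) = UpperCompatible-JI j jj j₀≤κj
      in subst (λ X → IT.JIP X × UT.κP X ≡ U.κP (j , a')) (sym (cong (j₀ A.∨ j ,_) (GB.∨-idem a')))
           (IT.JI-×ˡ _ jj∨ ,
            trans (UT.κP-fst (j₀ A.∨ j , a') refl) (trans (cong (_, b') κT≡κ) (sym (U.κP-fst (j , a') refl))))
    ... | inj₂ (refl , jj) =
      subst (λ X → IT.JIP X × UT.κP X ≡ U.κP (a , j'))
        (sym (cong₂ _,_ (GA.y≤x⇒x∨y≡x a≤j₀) (GB.x≤y⇒x∨y≡y (proj₁ (proj₁ jj)))))
        (IT.JI-×ʳ j' jj , trans (UT.κP-snd (j₀ , j') jj) (sym (U.κP-snd (a , j') jj)))

    upper-injective : ∀ J K → I.JIP J → I.JIP K → (j₀ , a') P.≤ U.κP J → (j₀ , a') P.≤ U.κP K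
      → (j₀ , a') P.∨ J ≡ (j₀ , a') P.∨ K → J ≡ K
    upper-injective (j , j') (k , k') jJ jK j₀≤κJ j₀≤κK eq
      with I.JI-cases (j , j') jJ | I.JI-cases (k , k') jK
    ... | inj₁ (jj , refl) | inj₁ (kk , refl) =
      cong (_, a') (UpperCompatible-injective j k jj kk (proj₁ (subst ((j₀ , a') P.≤_) (U.κP-fst (j , a') refl) j₀≤κJ))
                                           (proj₁ (subst ((j₀ , a') P.≤_) (U.κP-fst (k , a') refl) j₀≤κK))
                                           (cong proj₁ eq))
    ... | inj₁ (_ , refl) | inj₂ (refl , kk) = ⊥-elim (GB.JI⇒a∨j≢a∨a kk (sym (cong proj₂ eq)))
    ... | inj₂ (refl , jj) | inj₁ (_ , refl) = ⊥-elim (GB.JI⇒a∨j≢a∨a jj (cong proj₂ eq))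
    ... | inj₂ (refl , jj) | inj₂ (refl , kk) =
      cong (a ,_) (trans (sym (GB.x≤y⇒x∨y≡y (proj₁ (proj₁ jj))))
                         (trans (cong proj₂ eq) (GB.x≤y⇒x∨y≡y (proj₁ (proj₁ kk)))))

    upper-surjective : ∀ J' → IT.JIP J' → ∃[ J ] (I.JIP J × (j₀ , a') P.≤ U.κP J × (j₀ , a') P.∨ J ≡ J')
    upper-surjective (j , j') jJ' with IT.JI-cases (j , j') jJ'
    ... | inj₁ (jj' , refl) with UpperCompatible-surjective j jj'
    ...   | i , ii , j₀≤κi , j₀∨i≡j =
      (i , a') , I.JI-×ˡ i ii , subst ((j₀ , a') P.≤_) (sym (U.κP-fst (i , a') refl)) (j₀≤κi , a'≤b') ,
      cong₂ _,_ j₀∨i≡j (GB.∨-idem a')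
    upper-surjective (j , j') jJ' | inj₂ (refl , jj') =
      (a , j') , I.JI-×ʳ j' jj' ,
      subst ((j₀ , a') P.≤_) (sym (U.κP-snd (a , j') jj')) (j₀≤b , proj₁ (proj₁ (GB.pairing-MI U.pB j' jj'))) ,
      cong₂ _,_ (GA.y≤x⇒x∨y≡x a≤j₀) (GB.x≤y⇒x∨y≡y (proj₁ (proj₁ jj')))

    ×-upperCompatible : GP.UpperCompatible (a , a') (b , b') (j₀ , a') U.κP UT.κP
    ×-upperCompatible = upper-JI , upper-injective , upper-surjective

    meet-κP-fst : ∀ j → (m₀ , b') P.∧ U.κP (j , a') ≡ (m₀ A.∧ U.κ j , b')
    meet-κP-fst j = trans (cong ((m₀ , b') P.∧_) (U.κP-fst (j , a') refl)) (cong (m₀ A.∧ U.κ j ,_) (GB.∧-idem b'))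

    meet-κP-snd : ∀ j' → I.JIB j' → (m₀ , b') P.∧ U.κP (a , j') ≡ (m₀ , U.κ' j')
    meet-κP-snd j' jj = trans (cong ((m₀ , b') P.∧_) (U.κP-snd (a , j') jj))
      (cong₂ _,_ (GA.x≤y⇒x∧y≡x m₀≤b) (GB.y≤x⇒x∧y≡y (proj₂ (proj₁ (GB.pairing-MI U.pB j' jj)))))

    lower-MI : ∀ J → I.JIP J → J P.≤ (m₀ , b')
      → IB.MIP ((m₀ , b') P.∧ U.κP J) × IB.JIP J × UB.κP J ≡ (m₀ , b') P.∧ U.κP J
    lower-MI (j , j') jJ J≤M with I.JI-cases (j , j') jJ
    ... | inj₁ (jj , refl) =
      let (mi , ji , κB≡) = LowerCompatible-MI j jj (proj₁ J≤M) in
      subst IB.MIP (sym (meet-κP-fst j)) (IB.MI-×ˡ _ mi) , IB.JI-×ˡ j ji ,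
      trans (UB.κP-fst (j , a') refl) (trans (cong (_, b') κB≡) (sym (meet-κP-fst j)))
    ... | inj₂ (refl , jj) =
      subst IB.MIP (sym (meet-κP-snd j' jj)) (IB.MI-×ʳ _ (GB.pairing-MI U.pB j' jj)) , IB.JI-×ʳ j' jj ,
      trans (UB.κP-snd (a , j') jj) (sym (meet-κP-snd j' jj))

    lower-injective : ∀ J K → I.JIP J → I.JIP K → J P.≤ (m₀ , b') → K P.≤ (m₀ , b')
      → (m₀ , b') P.∧ U.κP J ≡ (m₀ , b') P.∧ U.κP K → U.κP J ≡ U.κP K
    lower-injective (j , j') (k , k') jJ jK J≤M K≤M eq
      with I.JI-cases (j , j') jJ | I.JI-cases (k , k') jK
    ... | inj₁ (jj , refl) | inj₁ (kk , refl) =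
      trans (U.κP-fst (j , a') refl) (trans (cong (_, b') κj≡κk) (sym (U.κP-fst (k , a') refl)))
      where
      κj≡κk : U.κ j ≡ U.κ k
      κj≡κk = LowerCompatible-injective j k jj kk (proj₁ J≤M) (proj₁ K≤M)
                (cong proj₁ (trans (sym (meet-κP-fst j)) (trans eq (meet-κP-fst k))))
    ... | inj₁ (_ , refl) | inj₂ (refl , kk) =
      ⊥-elim (proj₁ (proj₂ (GB.pairing-MI U.pB k' kk))
               (sym (cong proj₂ (trans (sym (meet-κP-fst j)) (trans eq (meet-κP-snd k' kk))))))
    ... | inj₂ (refl , jj) | inj₁ (_ , refl) =
      ⊥-elim (proj₁ (proj₂ (GB.pairing-MI U.pB j' jj))
               (cong proj₂ (trans (sym (meet-κP-snd j' jj)) (trans eq (meet-κP-fst k)))))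
    ... | inj₂ (refl , jj) | inj₂ (refl , kk) =
      trans (U.κP-snd (a , j') jj) (trans (cong (b ,_) κ'j≡κ'k) (sym (U.κP-snd (a , k') kk)))
      where
      κ'j≡κ'k : U.κ' j' ≡ U.κ' k'
      κ'j≡κ'k = cong proj₂ (trans (sym (meet-κP-snd j' jj)) (trans eq (meet-κP-snd k' kk)))

    lower-surjective : ∀ M' → IB.MIP M' → ∃[ J ] (I.JIP J × J P.≤ (m₀ , b') × (m₀ , b') P.∧ U.κP J ≡ M')
    lower-surjective (m , m') mM with IB.MI-cases (m , m') mM
    ... | inj₁ (mm , refl) with LowerCompatible-surjective m mm
    ...   | j , jj , j≤m₀ , m₀∧κj≡m =
      (j , a') , I.JI-×ˡ j jj , (j≤m₀ , a'≤b') , trans (meet-κP-fst j) (cong (_, b') m₀∧κj≡m)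
    lower-surjective (m , m') mM | inj₂ (refl , mm) with GB.pairing-surjective U.pB m' mm
    ...   | j' , jj , κ'j'≡m' =
      (a , j') , I.JI-×ʳ j' jj , (a≤m₀ , proj₂ (proj₁ jj)) , trans (meet-κP-snd j' jj) (cong (m₀ ,_) κ'j'≡m')

    ×-lowerCompatible : GP.LowerCompatible (a , a') (b , b') (m₀ , b') U.κP UB.κP
    ×-lowerCompatible = lower-MI , lower-injective , lower-surjective

  module DismantlingStepʳ {a b : A.Carrier} {a' b' : B.Carrier} (a≡b : a ≡ b)
     (up' : NB.Interval.UniquelyPaired a' b') (j₀ m₀ : B.Carrier) (pp : NB.Interval.PrimePair a' b' j₀ m₀)
     (upT : NB.Interval.UniquelyPaired j₀ b') (cdT : NB.CompDism j₀ b')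
     (cT : GB.UpperCompatible a' b' j₀ (GB.κ-of up') (GB.κ-of upT))
     (upB : NB.Interval.UniquelyPaired a' m₀) (cdB : NB.CompDism a' m₀)
     (cB : GB.LowerCompatible a' b' m₀ (GB.κ-of up') (GB.κ-of upB)) where
    cd' : NB.CompDism a' b'
    cd' = NB.step up' j₀ m₀ pp upT cdT cT upB cdB cB

    cd : NA.CompDism a b
    cd = NA.single a≡b

    up : NA.Interval.UniquelyPaired a b
    up = GA.CompDism⇒UniquelyPaired cd

    a'≤j₀ : a' B.≤ j₀
    a'≤j₀ = proj₁ (proj₁ pp)

    j₀≤b' : j₀ B.≤ b'
    j₀≤b' = proj₂ (proj₁ pp)

    a'≤m₀ : a' B.≤ m₀
    a'≤m₀ = proj₁ (proj₁ (proj₂ pp))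

    m₀≤b' : m₀ B.≤ b'
    m₀≤b' = proj₂ (proj₁ (proj₂ pp))

    a≤b : a A.≤ b
    a≤b = GA.≡⇒≤ a≡b

    module I = ProductInterval a b a' b' a≤b (B.≤-trans a'≤j₀ j₀≤b')
    module IT = ProductInterval a b j₀ b' a≤b j₀≤b'
    module IB = ProductInterval a b a' m₀ a≤b a'≤m₀
    module U = I.Pairing up cd up' cd'
    module UT = IT.Pairing up cd upT cdT
    module UB = IB.Pairing up cd upB cdB
    open GB.UpperCompatibleParts a' b' j₀ (GB.κ-of up') (GB.κ-of upT) cT
    open GB.LowerCompatibleParts a' b' m₀ (GB.κ-of up') (GB.κ-of upB) cB

    ×-primePair : NP.Interval.PrimePair (a , a') (b , b') (a , j₀) (b , m₀)
    ×-primePair =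
      let (_ , _ , split) = pp in
      I.In-bot₁ (a'≤j₀ , j₀≤b') , I.In-top₁ (a'≤m₀ , m₀≤b') ,
      λ X iX → ⊎-map (proj₂ (I.In-fst iX) ,_) (proj₁ (I.In-fst iX) ,_) (proj₁ (split (proj₂ X) (I.In-snd iX))) ,
               λ (X≤M , J≤X) → proj₂ (split (proj₂ X) (I.In-snd iX)) (proj₂ X≤M , proj₂ J≤X)

    upper-JI : ∀ J → I.JIP J → (a , j₀) P.≤ U.κP J
      → IT.JIP ((a , j₀) P.∨ J) × UT.κP ((a , j₀) P.∨ J) ≡ U.κP J
    upper-JI (j , j') jJ j₀≤κJ with I.JI-cases (j , j') jJ
    ... | inj₁ (jj , _) = ⊥-elim (GA.singleton-¬JI a≡b j jj)
    ... | inj₂ (refl , jj) =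
      let j₀≤κ'j' = proj₂ (subst ((a , j₀) P.≤_) (U.κP-snd (a , j') jj) j₀≤κJ)
          (jj∨ , κT≡κ) = UpperCompatible-JI j' jj j₀≤κ'j'
      in subst (λ X → IT.JIP X × UT.κP X ≡ U.κP (a , j')) (sym (cong (_, j₀ B.∨ j') (GA.∨-idem a)))
           (IT.JI-×ʳ _ jj∨ ,
            trans (UT.κP-snd (a , j₀ B.∨ j') jj∨) (trans (cong (b ,_) κT≡κ) (sym (U.κP-snd (a , j') jj))))

    upper-injective : ∀ J K → I.JIP J → I.JIP K → (a , j₀) P.≤ U.κP J → (a , j₀) P.≤ U.κP K
      → (a , j₀) P.∨ J ≡ (a , j₀) P.∨ K → J ≡ K
    upper-injective (j , j') (k , k') jJ jK j₀≤κJ j₀≤κK eq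
      with I.JI-cases (j , j') jJ | I.JI-cases (k , k') jK
    ... | inj₁ (jj , _) | _ = ⊥-elim (GA.singleton-¬JI a≡b j jj)
    ... | inj₂ _ | inj₁ (kk , _) = ⊥-elim (GA.singleton-¬JI a≡b k kk)
    ... | inj₂ (refl , jj) | inj₂ (refl , kk) =
      cong (a ,_) (UpperCompatible-injective j' k' jj kk (proj₂ (subst ((a , j₀) P.≤_) (U.κP-snd (a , j') jj) j₀≤κJ))
                                            (proj₂ (subst ((a , j₀) P.≤_) (U.κP-snd (a , k') kk) j₀≤κK))
                                            (cong proj₂ eq))

    upper-surjective : ∀ J' → IT.JIP J' → ∃[ J ] (I.JIP J × (a , j₀) P.≤ U.κP J × (a , j₀) P.∨ J ≡ J')
    upper-surjective (j , j') jJ' with IT.JI-cases (j , j') jJ'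
    ... | inj₁ (jj , _) = ⊥-elim (GA.singleton-¬JI a≡b j jj)
    ... | inj₂ (refl , jj') with UpperCompatible-surjective j' jj'
    ...   | i , ii , j₀≤κi , j₀∨i≡j' =
      (a , i) , I.JI-×ʳ i ii , subst ((a , j₀) P.≤_) (sym (U.κP-snd (a , i) ii)) (a≤b , j₀≤κi) ,
      cong₂ _,_ (GA.∨-idem a) j₀∨i≡j'

    ×-upperCompatible : GP.UpperCompatible (a , a') (b , b') (a , j₀) U.κP UT.κP
    ×-upperCompatible = upper-JI , upper-injective , upper-surjective

    meet-κP-snd : ∀ j' → I.JIB j' → (b , m₀) P.∧ U.κP (a , j') ≡ (b , m₀ B.∧ U.κ' j')
    meet-κP-snd j' jj = trans (cong ((b , m₀) P.∧_) (U.κP-snd (a , j') jj)) (cong (_, m₀ B.∧ U.κ' j') (GA.∧-idem b))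

    lower-MI : ∀ J → I.JIP J → J P.≤ (b , m₀)
      → IB.MIP ((b , m₀) P.∧ U.κP J) × IB.JIP J × UB.κP J ≡ (b , m₀) P.∧ U.κP J
    lower-MI (j , j') jJ J≤M with I.JI-cases (j , j') jJ
    ... | inj₁ (jj , _) = ⊥-elim (GA.singleton-¬JI a≡b j jj)
    ... | inj₂ (refl , jj) =
      let (mi , ji , κB≡) = LowerCompatible-MI j' jj (proj₂ J≤M) in
      subst IB.MIP (sym (meet-κP-snd j' jj)) (IB.MI-×ʳ _ mi) , IB.JI-×ʳ j' ji ,
      trans (UB.κP-snd (a , j') ji) (trans (cong (b ,_) κB≡) (sym (meet-κP-snd j' jj)))

    lower-injective : ∀ J K → I.JIP J → I.JIP K → J P.≤ (b , m₀) → K P.≤ (b , m₀)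
      → (b , m₀) P.∧ U.κP J ≡ (b , m₀) P.∧ U.κP K → U.κP J ≡ U.κP K
    lower-injective (j , j') (k , k') jJ jK J≤M K≤M eq
      with I.JI-cases (j , j') jJ | I.JI-cases (k , k') jK
    ... | inj₁ (jj , _) | _ = ⊥-elim (GA.singleton-¬JI a≡b j jj)
    ... | inj₂ _ | inj₁ (kk , _) = ⊥-elim (GA.singleton-¬JI a≡b k kk)
    ... | inj₂ (refl , jj) | inj₂ (refl , kk) =
      trans (U.κP-snd (a , j') jj) (trans (cong (b ,_) κ'j≡κ'k) (sym (U.κP-snd (a , k') kk)))
      where
      κ'j≡κ'k : U.κ' j' ≡ U.κ' k'
      κ'j≡κ'k = LowerCompatible-injective j' k' jj kk (proj₂ J≤M) (proj₂ K≤M)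
                  (cong proj₂ (trans (sym (meet-κP-snd j' jj)) (trans eq (meet-κP-snd k' kk))))

    lower-surjective : ∀ M' → IB.MIP M' → ∃[ J ] (I.JIP J × J P.≤ (b , m₀) × (b , m₀) P.∧ U.κP J ≡ M')
    lower-surjective (m , m') mM with IB.MI-cases (m , m') mM
    ... | inj₁ (mm , _) = ⊥-elim (GA.singleton-¬MI a≡b m mm)
    ... | inj₂ (refl , mm) with LowerCompatible-surjective m' mm
    ...   | j' , jj , j'≤m₀ , m₀∧κ'j'≡m' =
      (a , j') , I.JI-×ʳ j' jj , (a≤b , j'≤m₀) , trans (meet-κP-snd j' jj) (cong (b ,_) m₀∧κ'j'≡m')

    ×-lowerCompatible : GP.LowerCompatible (a , a') (b , b') (b , m₀) U.κP UB.κP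
    ×-lowerCompatible = lower-MI , lower-injective , lower-surjective

  ×-CompDism-singletonˡ : ∀ {a b a' b'} → a ≡ b → NB.CompDism a' b' → NP.CompDism (a , a') (b , b')
  ×-CompDism-singletonˡ e (NB.single e') = NP.single (cong₂ _,_ e e')
  ×-CompDism-singletonˡ {a} {b} e (NB.step up' j₀ m₀ pp upT cdT cT upB cdB cB) =
    NP.step S.U.×-uniquelyPaired (a , j₀) (b , m₀) S.×-primePair
      S.UT.×-uniquelyPaired (×-CompDism-singletonˡ e cdT) S.×-upperCompatible
      S.UB.×-uniquelyPaired (×-CompDism-singletonˡ e cdB) S.×-lowerCompatible
    where module S = DismantlingStepʳ e up' j₀ m₀ pp upT cdT cT upB cdB cB

  ×-CompDism : ∀ {a b a' b'} → NA.CompDism a b → NB.CompDism a' b' → NP.CompDism (a , a') (b , b')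
  ×-CompDism (NA.single e) cd' = ×-CompDism-singletonˡ e cd'
  ×-CompDism {a} {b} {a'} {b'} (NA.step up j₀ m₀ pp upT cdT cT upB cdB cB) cd' =
    NP.step S.U.×-uniquelyPaired (j₀ , a') (m₀ , b') S.×-primePair
      S.UT.×-uniquelyPaired (×-CompDism cdT cd') S.×-upperCompatible
      S.UB.×-uniquelyPaired (×-CompDism cdB cd') S.×-lowerCompatible
    where module S = DismantlingStepˡ up j₀ m₀ pp upT cdT cT upB cdB cB cd'

  module GaloisGraph (up : NA.Interval.UniquelyPaired A.⊥L A.⊤) (cd : NA.CompDism A.⊥L A.⊤)
                     (up' : NB.Interval.UniquelyPaired B.⊥L B.⊤) (cd' : NB.CompDism B.⊥L B.⊤) where
    module I = ProductInterval A.⊥L A.⊤ B.⊥L B.⊤ (A.⊥≤ A.⊤) (B.⊥≤ B.⊤)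
    open I.Pairing up cd up' cd' public using (κP; κP-fst; κP-snd; ×-uniquelyPaired)

    κ : A.Carrier → A.Carrier
    κ = GA.κ-of up

    κ' : B.Carrier → B.Carrier
    κ' = GB.κ-of up'

    module WA = NA.WithPairing κ
    module WB = NB.WithPairing κ'
    module WP = NP.WithPairing κP

    j≰κj : ∀ j → I.JIA j → ¬ (j A.≤ κ j)
    j≰κj = GA.pairing-j≰κj cd (GA.κ-of-isPairing up)

    j'≰κ'j' : ∀ j' → I.JIB j' → ¬ (j' B.≤ κ' j')
    j'≰κ'j' = GB.pairing-j≰κj cd' (GB.κ-of-isPairing up')

    -- In each of the next four lemmas the cover cannot move the other coordinate,
    -- since that would put j below κ j.

    InD-×ˡ : ∀ X j → WP.InD X (j , B.⊥L) → WA.InD (proj₁ X) j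
    InD-×ˡ X j (Y , Y⋖X , (jJ , Y≤κJ) , (_ , J≤X)) =
      [ (λ (Y₁⋖X₁ , _) → proj₁ Y , Y₁⋖X₁ , (jj , proj₁ Y≤κj) , (jj , proj₁ J≤X))
      , (λ (Y₁≡X₁ , _) → ⊥-elim (j≰κj j jj (A.≤-trans (proj₁ J≤X) (subst (A._≤ κ j) Y₁≡X₁ (proj₁ Y≤κj)))))
      ] (⋖-cases Y⋖X)
      where
      jj : I.JIA j
      jj = I.JI-×ˡ⁻ j jJ
      Y≤κj : Y P.≤ (κ j , B.⊤)
      Y≤κj = subst (Y P.≤_) (κP-fst (j , B.⊥L) refl) Y≤κJ

    InD-×ʳ : ∀ X j' → WP.InD X (A.⊥L , j') → WB.InD (proj₂ X) j'
    InD-×ʳ X j' (Y , Y⋖X , (jJ , Y≤κJ) , (_ , J≤X)) =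
      [ (λ (_ , Y₂≡X₂) → ⊥-elim (j'≰κ'j' j' jj (B.≤-trans (proj₂ J≤X) (subst (B._≤ κ' j') Y₂≡X₂ (proj₂ Y≤κj)))))
      , (λ (_ , Y₂⋖X₂) → proj₂ Y , Y₂⋖X₂ , (jj , proj₂ Y≤κj) , (jj , proj₂ J≤X))
      ] (⋖-cases Y⋖X)
      where
      jj : I.JIB j'
      jj = I.JI-×ʳ⁻ j' jJ
      Y≤κj : Y P.≤ (A.⊤ , κ' j')
      Y≤κj = subst (Y P.≤_) (κP-snd (A.⊥L , j') jj) Y≤κJ

    InU-×ˡ : ∀ X j → WP.InU X (j , B.⊥L) → WA.InU (proj₁ X) j
    InU-×ˡ X j (Y , X⋖Y , (jJ , X≤κJ) , (_ , J≤Y)) =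
      [ (λ (X₁⋖Y₁ , _) → proj₁ Y , X₁⋖Y₁ , (jj , proj₁ X≤κj) , (jj , proj₁ J≤Y))
      , (λ (X₁≡Y₁ , _) → ⊥-elim (j≰κj j jj (A.≤-trans (subst (j A.≤_) (sym X₁≡Y₁) (proj₁ J≤Y)) (proj₁ X≤κj))))
      ] (⋖-cases X⋖Y)
      where
      jj : I.JIA j
      jj = I.JI-×ˡ⁻ j jJ
      X≤κj : X P.≤ (κ j , B.⊤)
      X≤κj = subst (X P.≤_) (κP-fst (j , B.⊥L) refl) X≤κJ

    InU-×ʳ : ∀ X j' → WP.InU X (A.⊥L , j') → WB.InU (proj₂ X) j'
    InU-×ʳ X j' (Y , X⋖Y , (jJ , X≤κJ) , (_ , J≤Y)) =
      [ (λ (_ , X₂≡Y₂) → ⊥-elim (j'≰κ'j' j' jj (B.≤-trans (subst (j' B.≤_) (sym X₂≡Y₂) (proj₂ J≤Y)) (proj₂ X≤κj))))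
      , (λ (_ , X₂⋖Y₂) → proj₂ Y , X₂⋖Y₂ , (jj , proj₂ X≤κj) , (jj , proj₂ J≤Y))
      ] (⋖-cases X⋖Y)
      where
      jj : I.JIB j'
      jj = I.JI-×ʳ⁻ j' jJ
      X≤κj : X P.≤ (A.⊤ , κ' j')
      X≤κj = subst (X P.≤_) (κP-snd (A.⊥L , j') jj) X≤κJ

    -- A join-irreducible (j , ⊥) lies below κP (⊥ , k') = (⊤ , κ' k'), and symmetrically,
    -- so edges of the Galois graph only join irreducibles of the same kind.
    ×-independent : (SP : P.Carrier → Set) (SA : A.Carrier → Set) (SB : B.Carrier → Set)
      → (∀ J → SP J → I.JIP J) → (∀ j → SP (j , B.⊥L) → SA j) → (∀ j' → SP (A.⊥L , j') → SB j')
      → WA.Independent SA → WB.Independent SB → WP.Independent SP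
    ×-independent SP SA SB SP⊆JI toA toB indA indB (j , j') (k , k') sJ sK (J≢K , J≰κK)
      with I.JI-cases (j , j') (SP⊆JI _ sJ) | I.JI-cases (k , k') (SP⊆JI _ sK)
    ... | inj₁ (_ , refl) | inj₁ (_ , refl) =
      indA j k (toA j sJ) (toA k sK)
        ((λ j≡k → J≢K (cong (_, B.⊥L) j≡k)) ,
         λ j≤κk → J≰κK (subst ((j , B.⊥L) P.≤_) (sym (κP-fst (k , B.⊥L) refl)) (j≤κk , B.≤⊤ _)))
    ... | inj₁ (_ , refl) | inj₂ (refl , kk) =
      J≰κK (subst ((j , B.⊥L) P.≤_) (sym (κP-snd (A.⊥L , k') kk)) (A.≤⊤ _ , B.⊥≤ _))
    ... | inj₂ (refl , _) | inj₁ (_ , refl) =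
      J≰κK (subst ((A.⊥L , j') P.≤_) (sym (κP-fst (k , B.⊥L) refl)) (A.⊥≤ _ , B.≤⊤ _))
    ... | inj₂ (refl , _) | inj₂ (refl , kk) =
      indB j' k' (toB j' sJ) (toB k' sK)
        ((λ j'≡k' → J≢K (cong (A.⊥L ,_) j'≡k')) ,
         λ j'≤κ'k' → J≰κK (subst ((A.⊥L , j') P.≤_) (sym (κP-snd (A.⊥L , k') kk)) (A.≤⊤ _ , j'≤κ'k')))

    ×-independent-D : ∀ X → WA.Independent (WA.InD (proj₁ X)) → WB.Independent (WB.InD (proj₂ X))
      → WP.Independent (WP.InD X)
    ×-independent-D X = ×-independent (WP.InD X) (WA.InD (proj₁ X)) (WB.InD (proj₂ X))
      (λ _ (_ , _ , _ , (jJ , _)) → jJ) (InD-×ˡ X) (InD-×ʳ X)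

    ×-independent-U : ∀ X → WA.Independent (WA.InU (proj₁ X)) → WB.Independent (WB.InU (proj₂ X))
      → WP.Independent (WP.InU X)
    ×-independent-U X = ×-independent (WP.InU X) (WA.InU (proj₁ X)) (WB.InU (proj₂ X))
      (λ _ (_ , _ , _ , (jJ , _)) → jJ) (InU-×ˡ X) (InU-×ʳ X)

theorem7p3 : (L L' : FinLattice) → Semidistrim L → Semidistrim L' → Semidistrim (L ×L L')
theorem7p3 L L' (up , cd , indep) (up' , cd' , indep') =
  ×-uniquelyPaired , ×-CompDism cd cd' ,
  λ X → ×-independent-D X (proj₁ (indep (proj₁ X))) (proj₁ (indep' (proj₂ X))) ,
        ×-independent-U X (proj₂ (indep (proj₁ X))) (proj₂ (indep' (proj₂ X)))
  where
  open Product L L' (LatticeProperties.CompDism⇒DecidableEquality L cd)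
                    (LatticeProperties.CompDism⇒DecidableEquality L' cd')
  open GaloisGraph up cd up' cd'
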